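{- Let $\mathcal O$ be a Cohen ring of a field of characteristic $p$, $R^+=\mathcal O[[S]]$, and let $\mathfrak p,\mathfrak q$ be Eisenstein prime ideals of $R^+$. For $x\in R^+$, if \[\min\bigl(v_{\kappa(\mathfrak p)}(x\bmod\mathfrak p),v_{\kappa(\mathfrak q)}(x\bmod\mathfrak q)\bigr)<\min(\deg\mathfrak p,\deg\mathfrak q),\] then $v_{\kappa(\mathfrak p)}(x\bmod\mathfrak p)=v_{\kappa(\mathfrak q)}(x\bmod\mathfrak q)$.
   Context: An Eisenstein polynomial is $P=S^e+a_{e-1}S^{e-1}+\dots+a_0\in\mathcal O[S]$ with $a_i\in\mathcal O$, $p\mid a_i$ for all $i$ and $p^2\nmid a_0$; an Eisenstein prime ideal is an ideal of $R^+$ generated by such $P$, with $\deg\mathfrak p=e$ if $e\ne0$ and $\deg\mathfrak p=\infty$ if $e=0$. $R^+/\mathfrak p$ is a complete discrete valuation ring with uniformizer the image of $S$; $\kappa(\mathfrak p)$ is its fraction field and $v_{\kappa(\mathfrak p)}$ the normalized valuation (value $1$ on the image of $S$). -}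

module Defs where

open import Level using (Level; _⊔_)
open import Algebra.Bundles using (CommutativeRing)
open import Data.Nat as ℕ using (ℕ; zero; suc; _∸_; _<?_; _≟_)
open import Data.Nat.Primality using (Prime)
open import Data.Fin using (Fin; fromℕ<)
open import Data.Product using (Σ; ∃; _×_; _,_)
open import Data.Sum using (_⊎_)
open import Data.Unit using (⊤)
open import Relation.Nullary using (¬_; yes; no)

module _ {c ℓ : Level} (R : CommutativeRing c ℓ) where
  open CommutativeRing R

  natCast : ℕ → Carrier
  natCast zero    = 0#
  natCast (suc n) = 1# + natCast n

  pow : Carrier → ℕ → Carrier
  pow x zero    = 1#
  pow x (suc n) = x * pow x n

  _∣R_ : Carrier → Carrier → Set (c ⊔ ℓ)
  a ∣R b = Σ Carrier λ y → b ≈ a * y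

  IsUnit : Carrier → Set (c ⊔ ℓ)
  IsUnit u = Σ Carrier λ v → u * v ≈ 1#

  -- O is a Cohen ring of a field of characteristic p (p prime): a complete
  -- discrete valuation ring whose maximal ideal is generated by π = p·1
  -- (so the residue field O/πO has characteristic p).
  record IsCohenRing (p : ℕ) : Set (c ⊔ ℓ) where
    field
      prime      : Prime p
      π≉0        : ¬ (natCast p ≈ 0#)
      domain     : ∀ x y → ¬ (x ≈ 0#) → ¬ (y ≈ 0#) → ¬ (x * y ≈ 0#)
      -- local with maximal ideal πO: every non-unit is divisible by π
      maximal    : ∀ x → ¬ IsUnit x → natCast p ∣R x
      separated  : ∀ x → (∀ n → pow (natCast p) n ∣R x) → x ≈ 0#
      complete   : (s : ℕ → Carrier) →
                   (∀ n → pow (natCast p) n ∣R (s (suc n) - s n)) →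
                   Σ Carrier λ l → ∀ n → pow (natCast p) n ∣R (l - s n)

  -- R⁺ = O[[S]] : formal power series as coefficient sequences
  PowerSeries : Set c
  PowerSeries = ℕ → Carrier

  _≈PS_ : PowerSeries → PowerSeries → Set ℓ
  f ≈PS g = ∀ n → f n ≈ g n

  _+PS_ : PowerSeries → PowerSeries → PowerSeries
  (f +PS g) n = f n + g n

  sumBelow : (ℕ → Carrier) → ℕ → Carrier
  sumBelow h zero    = 0#
  sumBelow h (suc n) = sumBelow h n + h n

  _*PS_ : PowerSeries → PowerSeries → PowerSeries
  (f *PS g) n = sumBelow (λ i → f i * g (n ∸ i)) (suc n)

  Spow : ℕ → PowerSeries
  Spow n k with k ≟ n
  ... | yes _ = 1#
  ... | no  _ = 0#

  -- Eisenstein polynomials generating the Eisenstein prime ideals.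
  --   eisFin e a : the polynomial S^(e+1) + a_e S^e + … + a_0 (degree e+1 ≥ 1)
  --   eisInf a₀  : the case e = 0 (degree ∞): the constant a₀ with p ∣ a₀, p² ∤ a₀,
  --                generating the ideal pR⁺
  data Eisenstein (p : ℕ) : Set (c ⊔ ℓ) where
    eisFin : (e : ℕ) (a : Fin (suc e) → Carrier) →
             (∀ i → natCast p ∣R a i) →
             ¬ (pow (natCast p) 2 ∣R a (fromℕ< (ℕ.s≤s ℕ.z≤n))) →
             Eisenstein p
    eisInf : (a₀ : Carrier) → natCast p ∣R a₀ → ¬ (pow (natCast p) 2 ∣R a₀) →
             Eisenstein p

  generator : {p : ℕ} → Eisenstein p → PowerSeries
  generator (eisFin e a _ _) k with k <? suc e
  ... | yes k<e = a (fromℕ< k<e)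
  ... | no  _ with k ≟ suc e
  ...   | yes _ = 1#
  ...   | no  _ = 0#
  generator (eisInf a₀ _ _) zero    = a₀
  generator (eisInf a₀ _ _) (suc k) = 0#

  _<deg_ : {p : ℕ} → ℕ → Eisenstein p → Set
  n <deg eisFin e _ _ _ = n ℕ.< suc e
  n <deg eisInf _ _ _   = ⊤

  -- v_{κ(𝔭)}(x mod 𝔭) ≥ n : the image of S^n divides x mod 𝔭 in R⁺/𝔭,
  -- i.e. x ∈ 𝔭 + S^n R⁺
  ValGeq : {p : ℕ} → Eisenstein p → PowerSeries → ℕ → Set (c ⊔ ℓ)
  ValGeq P x n = Σ PowerSeries λ y → Σ PowerSeries λ z →
                   x ≈PS ((generator P *PS y) +PS (Spow n *PS z))

  -- v_{κ(𝔭)}(x mod 𝔭) = n  (normalised: the image of S is a uniformiser)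
  ValEq : {p : ℕ} → Eisenstein p → PowerSeries → ℕ → Set (c ⊔ ℓ)
  ValEq P x n = ValGeq P x n × ¬ ValGeq P x (suc n)

-- Suppose v_𝔭(x) = n and v_𝔮(x) ≥ n+1 with n below both degrees. Every coefficient of an
-- Eisenstein polynomial in degree ≤ n is divisible by p, so x ∈ 𝔮 + Sⁿ⁺¹R⁺ forces p ∣ xₙ.
-- Writing x = P y + Sⁿ z, also p ∣ (P y)ₙ, hence p ∣ z₀. As P₀ = p·w with w a unit
-- (because p² ∤ P₀ and O is local with maximal ideal pO), z₀ is a multiple of P₀, and
-- replacing y by y + (z₀/P₀) Sⁿ pushes x into 𝔭 + Sⁿ⁺¹R⁺, contradicting v_𝔭(x) = n.
module Submission where

open import Defs
open import Level using (Level)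
open import Algebra.Bundles using (CommutativeRing)
open import Data.Nat using (ℕ)
open import Data.Product using (_×_)
open import Data.Sum using (_⊎_)

open import Data.Nat using (zero; suc; _∸_; _≤_; _<_; _≟_; _<?_; s≤s)
import Data.Nat as ℕ
open import Data.Nat.Properties
  using (≤-refl; <-irrefl; ≤-<-trans; m≤n⇒m≤1+n; ≤∧≢⇒<; ≤-pred; ≮⇒≥;
         m∸n≤m; m∸n+n≡m; m∸[m∸n]≡n; n∸n≡0; m<1+n⇒m<n∨m≡n)
open import Data.Product using (Σ; _,_; proj₁; proj₂)
open import Data.Sum using (inj₁; inj₂)
open import Data.Empty using (⊥-elim)
open import Relation.Nullary using (¬_; yes; no)
open import Relation.Binary.PropositionalEquality using (_≡_; _≢_; refl; cong)
  renaming (sym to ≡-sym; trans to ≡-trans)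
import Algebra.Properties.Group as GroupProperties
import Algebra.Properties.Ring as RingProperties
import Relation.Binary.Reasoning.Setoid as SetoidReasoning

module PowerSeriesArithmetic {c ℓ : Level} (R : CommutativeRing c ℓ) where
  open CommutativeRing R renaming (refl to ≈-refl)
  open GroupProperties +-group using (//-rightDividesˡ)
  open RingProperties ring using (-‿distribʳ-*)
  open SetoidReasoning setoid

  _∣_ : Carrier → Carrier → Set _
  _∣_ = _∣R_ R

  _⊛_ : PowerSeries R → PowerSeries R → PowerSeries R
  _⊛_ = _*PS_ R

  Σ< : (ℕ → Carrier) → ℕ → Carrier
  Σ< = sumBelow R

  x+[y-x]≈y : ∀ x y → x + (y - x) ≈ y
  x+[y-x]≈y x y = trans (+-comm x (y - x)) (//-rightDividesˡ x y)

  ∣-respʳ : ∀ {a b b′} → b ≈ b′ → a ∣ b → a ∣ b′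
  ∣-respʳ b≈b′ (q , b≈aq) = q , trans (sym b≈b′) b≈aq

  ∣0 : ∀ {a} → a ∣ 0#
  ∣0 {a} = 0# , sym (zeroʳ a)

  ∣-+ : ∀ {a b b′} → a ∣ b → a ∣ b′ → a ∣ (b + b′)
  ∣-+ {a} (q , b≈aq) (q′ , b′≈aq′) = q + q′ , trans (+-cong b≈aq b′≈aq′) (sym (distribˡ a q q′))

  ∣-*ʳ : ∀ {a b} d → a ∣ b → a ∣ (b * d)
  ∣-*ʳ {a} d (q , b≈aq) = q * d , trans (*-congʳ b≈aq) (*-assoc a q d)

  ∣-neg : ∀ {a b} → a ∣ b → a ∣ (- b)
  ∣-neg {a} {b} (q , b≈aq) = - q , (begin
    - b        ≈⟨ -‿cong b≈aq ⟩
    - (a * q)  ≈⟨ -‿distribʳ-* a q ⟩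
    a * - q    ∎)

  ∣-sumBelow : ∀ {a} h n → (∀ i → i < n → a ∣ h i) → a ∣ Σ< h n
  ∣-sumBelow h zero    a∣h = ∣0
  ∣-sumBelow h (suc n) a∣h =
    ∣-+ (∣-sumBelow h n λ i i<n → a∣h i (m≤n⇒m≤1+n i<n)) (a∣h n ≤-refl)

  ∣-unit-cofactor : ∀ {a b u d} → a ≈ b * u → IsUnit R u → b ∣ d → a ∣ d
  ∣-unit-cofactor {a} {b} {u} {d} a≈bu (v , uv≈1) (t , d≈bt) = v * t , (begin
    d                  ≈⟨ d≈bt ⟩
    b * t              ≈⟨ *-congˡ (*-identityˡ t) ⟨
    b * (1# * t)       ≈⟨ *-congˡ (*-congʳ uv≈1) ⟨
    b * ((u * v) * t)  ≈⟨ *-congˡ (*-assoc u v t) ⟩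
    b * (u * (v * t))  ≈⟨ *-assoc b u (v * t) ⟨
    (b * u) * (v * t)  ≈⟨ *-congʳ a≈bu ⟨
    a * (v * t)        ∎)

  sumBelow-cong : ∀ h g n → (∀ i → i < n → h i ≈ g i) → Σ< h n ≈ Σ< g n
  sumBelow-cong h g zero    h≈g = ≈-refl
  sumBelow-cong h g (suc n) h≈g =
    +-cong (sumBelow-cong h g n λ i i<n → h≈g i (m≤n⇒m≤1+n i<n)) (h≈g n ≤-refl)

  sumBelow-zero : ∀ h n → (∀ i → i < n → h i ≈ 0#) → Σ< h n ≈ 0#
  sumBelow-zero h zero    h≈0 = ≈-refl
  sumBelow-zero h (suc n) h≈0 = begin
    Σ< h n + h n  ≈⟨ +-cong (sumBelow-zero h n λ i i<n → h≈0 i (m≤n⇒m≤1+n i<n)) (h≈0 n ≤-refl) ⟩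
    0# + 0#       ≈⟨ +-identityʳ 0# ⟩
    0#            ∎

  sumBelow-+ : ∀ h g n → Σ< (λ i → h i + g i) n ≈ Σ< h n + Σ< g n
  sumBelow-+ h g zero    = sym (+-identityʳ 0#)
  sumBelow-+ h g (suc n) = begin
    Σ< (λ i → h i + g i) n + (h n + g n)  ≈⟨ +-congʳ (sumBelow-+ h g n) ⟩
    (Σ< h n + Σ< g n) + (h n + g n)        ≈⟨ +-assoc (Σ< h n) (Σ< g n) (h n + g n) ⟩
    Σ< h n + (Σ< g n + (h n + g n))        ≈⟨ +-congˡ (+-assoc (Σ< g n) (h n) (g n)) ⟨
    Σ< h n + ((Σ< g n + h n) + g n)        ≈⟨ +-congˡ (+-congʳ (+-comm (Σ< g n) (h n))) ⟩
    Σ< h n + ((h n + Σ< g n) + g n)        ≈⟨ +-congˡ (+-assoc (h n) (Σ< g n) (g n)) ⟩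
    Σ< h n + (h n + (Σ< g n + g n))        ≈⟨ +-assoc (Σ< h n) (h n) (Σ< g n + g n) ⟨
    (Σ< h n + h n) + (Σ< g n + g n)        ∎

  sumBelow-single : ∀ h n j → j < n → (∀ i → i < n → i ≢ j → h i ≈ 0#) → Σ< h n ≈ h j
  sumBelow-single h (suc n) j j<1+n h≈0 with j ≟ n
  ... | yes refl = begin
    Σ< h n + h n  ≈⟨ +-congʳ (sumBelow-zero h n λ i i<n →
                       h≈0 i (m≤n⇒m≤1+n i<n) λ { refl → <-irrefl refl i<n }) ⟩
    0# + h n      ≈⟨ +-identityˡ (h n) ⟩
    h n           ∎
  ... | no j≢n = begin
    Σ< h n + h n  ≈⟨ +-cong (sumBelow-single h n j (≤∧≢⇒< (≤-pred j<1+n) j≢n) λ i i<n →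
                               h≈0 i (m≤n⇒m≤1+n i<n))
                            (h≈0 n ≤-refl λ { refl → j≢n refl }) ⟩
    h j + 0#      ≈⟨ +-identityʳ (h j) ⟩
    h j           ∎

  Spow-≢ : ∀ n k → k ≢ n → Spow R n k ≈ 0#
  Spow-≢ n k k≢n with k ≟ n
  ... | yes k≡n = ⊥-elim (k≢n k≡n)
  ... | no  _   = ≈-refl

  Spow-≡ : ∀ n k → k ≡ n → Spow R n k ≈ 1#
  Spow-≡ n k k≡n with k ≟ n
  ... | yes _   = ≈-refl
  ... | no  k≢n = ⊥-elim (k≢n k≡n)

  Spow-⊛-below : ∀ m z k → k < m → (Spow R m ⊛ z) k ≈ 0#
  Spow-⊛-below m z k k<m = sumBelow-zero _ (suc k) λ i i≤k →
    trans (*-congʳ (Spow-≢ m i λ { refl → <-irrefl refl (≤-<-trans (≤-pred i≤k) k<m) }))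
          (zeroˡ (z (k ∸ i)))

  Spow-⊛-above : ∀ m z k → m ≤ k → (Spow R m ⊛ z) k ≈ z (k ∸ m)
  Spow-⊛-above m z k m≤k = begin
    (Spow R m ⊛ z) k          ≈⟨ sumBelow-single _ (suc k) m (s≤s m≤k) (λ i _ i≢m →
                                    trans (*-congʳ (Spow-≢ m i i≢m)) (zeroˡ (z (k ∸ i)))) ⟩
    Spow R m m * z (k ∸ m)    ≈⟨ *-congʳ (Spow-≡ m m refl) ⟩
    1# * z (k ∸ m)            ≈⟨ *-identityˡ (z (k ∸ m)) ⟩
    z (k ∸ m)                 ∎

  monomial : ℕ → Carrier → PowerSeries R
  monomial n a j = Spow R n j * a

  ⊛-monomial-below : ∀ G n a k → k < n → (G ⊛ monomial n a) k ≈ 0#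
  ⊛-monomial-below G n a k k<n = sumBelow-zero _ (suc k) λ i _ → begin
    G i * (Spow R n (k ∸ i) * a)  ≈⟨ *-congˡ (*-congʳ (Spow-≢ n (k ∸ i) λ k∸i≡n →
                                       <-irrefl k∸i≡n (≤-<-trans (m∸n≤m k i) k<n))) ⟩
    G i * (0# * a)                ≈⟨ *-congˡ (zeroˡ a) ⟩
    G i * 0#                      ≈⟨ zeroʳ (G i) ⟩
    0#                            ∎

  ⊛-monomial-above : ∀ G n a k → n ≤ k → (G ⊛ monomial n a) k ≈ G (k ∸ n) * a
  ⊛-monomial-above G n a k n≤k = begin
    (G ⊛ monomial n a) k                        ≈⟨ sumBelow-single _ (suc k) (k ∸ n)
                                                     (s≤s (m∸n≤m k n)) off-diagonal ⟩
    G (k ∸ n) * (Spow R n (k ∸ (k ∸ n)) * a)    ≈⟨ *-congˡ (*-congʳ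
                                                     (Spow-≡ n (k ∸ (k ∸ n)) (m∸[m∸n]≡n n≤k))) ⟩
    G (k ∸ n) * (1# * a)                        ≈⟨ *-congˡ (*-identityˡ a) ⟩
    G (k ∸ n) * a                               ∎
    where
    off-diagonal : ∀ i → i < suc k → i ≢ k ∸ n → G i * (Spow R n (k ∸ i) * a) ≈ 0#
    off-diagonal i i≤k i≢k∸n = begin
      G i * (Spow R n (k ∸ i) * a)  ≈⟨ *-congˡ (*-congʳ (Spow-≢ n (k ∸ i) λ k∸i≡n →
                                         i≢k∸n (≡-trans (≡-sym (m∸[m∸n]≡n (≤-pred i≤k)))
                                                        (cong (k ∸_) k∸i≡n)))) ⟩
      G i * (0# * a)                ≈⟨ *-congˡ (zeroˡ a) ⟩
      G i * 0#                      ≈⟨ zeroʳ (G i) ⟩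
      0#                            ∎

  ⊛-distribˡ-+PS : ∀ G y h k → (G ⊛ (_+PS_ R y h)) k ≈ (G ⊛ y) k + (G ⊛ h) k
  ⊛-distribˡ-+PS G y h k =
    trans (sumBelow-cong _ _ (suc k) λ i _ → distribˡ (G i) (y (k ∸ i)) (h (k ∸ i)))
          (sumBelow-+ _ _ (suc k))

  AgreeBelow : ℕ → PowerSeries R → PowerSeries R → Set ℓ
  AgreeBelow m f g = ∀ k → k < m → f k ≈ g k

  module _ {G x : PowerSeries R} where

    split⇒agreeBelow : ∀ m y z → _≈PS_ R x (_+PS_ R (G ⊛ y) (Spow R m ⊛ z)) →
                       AgreeBelow m x (G ⊛ y)
    split⇒agreeBelow m y z x≈ k k<m = begin
      x k                             ≈⟨ x≈ k ⟩
      (G ⊛ y) k + (Spow R m ⊛ z) k    ≈⟨ +-congˡ (Spow-⊛-below m z k k<m) ⟩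
      (G ⊛ y) k + 0#                  ≈⟨ +-identityʳ ((G ⊛ y) k) ⟩
      (G ⊛ y) k                       ∎

    agreeBelow⇒split : ∀ m y → AgreeBelow m x (G ⊛ y) →
                       Σ (PowerSeries R) λ z → _≈PS_ R x (_+PS_ R (G ⊛ y) (Spow R m ⊛ z))
    agreeBelow⇒split m y x≈Gy = z , x≈
      where
      z : PowerSeries R
      z j = x (j ℕ.+ m) - (G ⊛ y) (j ℕ.+ m)

      x≈ : ∀ k → x k ≈ (G ⊛ y) k + (Spow R m ⊛ z) k
      x≈ k with k <? m
      ... | yes k<m = begin
        x k                           ≈⟨ x≈Gy k k<m ⟩
        (G ⊛ y) k                     ≈⟨ +-identityʳ ((G ⊛ y) k) ⟨
        (G ⊛ y) k + 0#                ≈⟨ +-congˡ (Spow-⊛-below m z k k<m) ⟨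
        (G ⊛ y) k + (Spow R m ⊛ z) k  ∎
      ... | no k≮m = begin
        x k                             ≈⟨ x+[y-x]≈y ((G ⊛ y) k) (x k) ⟨
        (G ⊛ y) k + (x k - (G ⊛ y) k)   ≈⟨ +-congˡ (reflexive (cong (λ j → x j - (G ⊛ y) j)
                                                                     (≡-sym (m∸n+n≡m (≮⇒≥ k≮m))))) ⟩
        (G ⊛ y) k + z (k ∸ m)           ≈⟨ +-congˡ (Spow-⊛-above m z k (≮⇒≥ k≮m)) ⟨
        (G ⊛ y) k + (Spow R m ⊛ z) k    ∎

    -- Adding (defect / G₀)·Sⁿ to y kills the defect at degree n.
    agreeBelow-extend : ∀ n y → AgreeBelow n x (G ⊛ y) → G 0 ∣ (x n - (G ⊛ y) n) →
                        Σ (PowerSeries R) λ y′ → AgreeBelow (suc n) x (G ⊛ y′)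
    agreeBelow-extend n y x≈Gy (a , defect≈G₀a) = _+PS_ R y (monomial n a) , x≈Gy′
      where
      x≈Gy′ : AgreeBelow (suc n) x (G ⊛ _+PS_ R y (monomial n a))
      x≈Gy′ k k<1+n with m<1+n⇒m<n∨m≡n k<1+n
      ... | inj₁ k<n = begin
        x k                                  ≈⟨ x≈Gy k k<n ⟩
        (G ⊛ y) k                            ≈⟨ +-identityʳ ((G ⊛ y) k) ⟨
        (G ⊛ y) k + 0#                       ≈⟨ +-congˡ (⊛-monomial-below G n a k k<n) ⟨
        (G ⊛ y) k + (G ⊛ monomial n a) k     ≈⟨ ⊛-distribˡ-+PS G y (monomial n a) k ⟨
        (G ⊛ _+PS_ R y (monomial n a)) k     ∎
      ... | inj₂ refl = begin
        x n                                  ≈⟨ x+[y-x]≈y ((G ⊛ y) n) (x n) ⟨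
        (G ⊛ y) n + (x n - (G ⊛ y) n)        ≈⟨ +-congˡ defect≈G₀a ⟩
        (G ⊛ y) n + G 0 * a                  ≈⟨ +-congˡ (*-congʳ (reflexive (cong G (n∸n≡0 n)))) ⟨
        (G ⊛ y) n + G (n ∸ n) * a            ≈⟨ +-congˡ (⊛-monomial-above G n a n ≤-refl) ⟨
        (G ⊛ y) n + (G ⊛ monomial n a) n     ≈⟨ ⊛-distribˡ-+PS G y (monomial n a) n ⟨
        (G ⊛ _+PS_ R y (monomial n a)) n     ∎

module EisensteinIdeals {c ℓ : Level} (O : CommutativeRing c ℓ) (p : ℕ) (cohen : IsCohenRing O p)
  where
  open CommutativeRing O hiding (refl)
  open PowerSeriesArithmetic O
  open IsCohenRing cohen using (maximal)
  open SetoidReasoning setoid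

  π : Carrier
  π = natCast O p

  π∣generator : ∀ (P : Eisenstein O p) {n} → _<deg_ O n P → ∀ i → i ≤ n → π ∣ generator O P i
  π∣generator (eisFin e a π∣a _) n<deg i i≤n with i <? suc e
  ... | yes _   = π∣a _
  ... | no  i≮e = ⊥-elim (i≮e (≤-<-trans i≤n n<deg))
  π∣generator (eisInf a₀ π∣a₀ _) _ zero    _ = π∣a₀
  π∣generator (eisInf a₀ π∣a₀ _) _ (suc i) _ = ∣0

  π∣generator-⊛ : ∀ (P : Eisenstein O p) {n} → _<deg_ O n P → ∀ y → π ∣ (generator O P ⊛ y) n
  π∣generator-⊛ P n<deg y = ∣-sumBelow _ _ λ i i≤n →
    ∣-*ʳ (y (_ ∸ i)) (π∣generator P n<deg i (≤-pred i≤n))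

  π∣constant-term : (P : Eisenstein O p) → π ∣ generator O P 0
  π∣constant-term (eisFin e a π∣a _) = π∣a _
  π∣constant-term (eisInf a₀ π∣a₀ _) = π∣a₀

  π²∤constant-term : (P : Eisenstein O p) → ¬ (pow O π 2 ∣ generator O P 0)
  π²∤constant-term (eisFin e a _ π²∤a₀) = π²∤a₀
  π²∤constant-term (eisInf a₀ _ π²∤a₀) = π²∤a₀

  π²∣π*nonunit : ∀ {a w} → a ≈ π * w → ¬ IsUnit O w → pow O π 2 ∣ a
  π²∣π*nonunit {a} {w} a≈πw w-nonunit with maximal w w-nonunit
  ... | s , w≈πs = s , (begin
    a                   ≈⟨ a≈πw ⟩
    π * w               ≈⟨ *-congˡ w≈πs ⟩
    π * (π * s)         ≈⟨ *-congˡ (*-congʳ (*-identityʳ π)) ⟨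
    π * ((π * 1#) * s)  ≈⟨ *-assoc π (π * 1#) s ⟨
    (π * (π * 1#)) * s  ∎)

  ValGeq-suc⇒π∣coefficient : ∀ (Q : Eisenstein O p) {x n} → _<deg_ O n Q →
                              ValGeq O Q x (suc n) → π ∣ x n
  ValGeq-suc⇒π∣coefficient Q {n = n} n<deg (y , z , x≈) =
    ∣-respʳ (sym (split⇒agreeBelow (suc n) y z x≈ n ≤-refl)) (π∣generator-⊛ Q n<deg y)

  ValEq⇒¬ValGeq-suc : ∀ (P Q : Eisenstein O p) {x n} → _<deg_ O n P → _<deg_ O n Q →
                      ValEq O P x n → ¬ ValGeq O Q x (suc n)
  ValEq⇒¬ValGeq-suc P Q {x} {n} n<degP n<degQ ((y , z , x≈) , ¬ValGeq-P) ValGeq-Q =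
    π²∤constant-term P (π²∣π*nonunit P₀≈πw λ w-unit → ¬ValGeq-P (ValGeq-P w-unit))
    where
    G = generator O P
    w = proj₁ (π∣constant-term P)
    P₀≈πw = proj₂ (π∣constant-term P)

    π∣defect : π ∣ (x n - (G ⊛ y) n)
    π∣defect = ∣-+ (ValGeq-suc⇒π∣coefficient Q n<degQ ValGeq-Q)
                   (∣-neg (π∣generator-⊛ P n<degP y))

    ValGeq-P : IsUnit O w → ValGeq O P x (suc n)
    ValGeq-P w-unit
      with agreeBelow-extend n y (split⇒agreeBelow n y z x≈) (∣-unit-cofactor P₀≈πw w-unit π∣defect)
    ... | y′ , x≈Gy′ = y′ , agreeBelow⇒split (suc n) y′ x≈Gy′

lemma3p1p9 : {c ℓ : Level} (O : CommutativeRing c ℓ) (p : ℕ) → IsCohenRing O p →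
             (𝔭 𝔮 : Eisenstein O p) (x : PowerSeries O) (n : ℕ) →
             _<deg_ O n 𝔭 → _<deg_ O n 𝔮 →
             ((ValEq O 𝔭 x n × ValGeq O 𝔮 x n) ⊎ (ValEq O 𝔮 x n × ValGeq O 𝔭 x n)) →
             ValEq O 𝔭 x n × ValEq O 𝔮 x n
lemma3p1p9 O p cohen 𝔭 𝔮 x n n<deg𝔭 n<deg𝔮 (inj₁ (ValEq-𝔭 , ValGeq-𝔮)) =
  ValEq-𝔭 , (ValGeq-𝔮 , ValEq⇒¬ValGeq-suc 𝔭 𝔮 n<deg𝔭 n<deg𝔮 ValEq-𝔭)
  where open EisensteinIdeals O p cohen
lemma3p1p9 O p cohen 𝔭 𝔮 x n n<deg𝔭 n<deg𝔮 (inj₂ (ValEq-𝔮 , ValGeq-𝔭)) =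
  (ValGeq-𝔭 , ValEq⇒¬ValGeq-suc 𝔮 𝔭 n<deg𝔮 n<deg𝔭 ValEq-𝔮) , ValEq-𝔮
  where open EisensteinIdeals O p cohen
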